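{- Let $p$ be a prime and let $S\subseteq\mathbb{Z}_{p^2}$ be a generating set of the additive group $\mathbb{Z}_{p^2}$ with $S=-S$ and $0\notin S$. If $|S|<\frac{p-1}{2}$, then $O\chi(\Gamma(\mathbb{Z}_{p^2},S))=p$.
   Context: For an additive group $G$ and a subset $S\subseteq G$ closed under negation with $0\notin S$, the Cayley graph $\Gamma(G,S)$ has vertex set $G$, with $u$ and $v$ adjacent if and only if $u-v\in S$. All colourings are proper vertex colourings. Two colourings of a graph are orthogonal if whenever two distinct vertices receive the same colour in one colouring, they receive distinct colours in the other. An orthogonal colouring is a pair of orthogonal proper colourings; $O\chi(G)$ is the minimum number of colours needed for an orthogonal colouring of $G$ (both colourings drawing from the same set of that many colours). -}

module Defs where

open import Data.Nat using (ℕ; zero; suc; _+_; _*_; _∸_; _≤_; NonZero)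
open import Data.Nat.DivMod using (_%_; m%n<n)
open import Data.Fin using (Fin; toℕ; fromℕ<)
open import Data.Fin.Subset using (Subset; _∈_; _∉_)
open import Data.Product using (Σ; ∃; _×_)
open import Relation.Binary.PropositionalEquality using (_≡_; _≢_)

module ZMod (n : ℕ) .{{_ : NonZero n}} where

  ℤₙ : Set
  ℤₙ = Fin n

  reduce : ℕ → ℤₙ
  reduce m = fromℕ< (m%n<n m n)

  0ₙ : ℤₙ
  0ₙ = reduce 0

  _+ₙ_ : ℤₙ → ℤₙ → ℤₙ
  a +ₙ b = reduce (toℕ a + toℕ b)

  -ₙ_ : ℤₙ → ℤₙ
  -ₙ a = reduce (n ∸ toℕ a)

  _-ₙ_ : ℤₙ → ℤₙ → ℤₙ
  a -ₙ b = a +ₙ (-ₙ b)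

  SymmetricSet : Subset n → Set
  SymmetricSet S = ∀ x → x ∈ S → (-ₙ x) ∈ S

  data InSpan (S : Subset n) : ℤₙ → Set where
    span-zero : InSpan S 0ₙ
    span-add  : ∀ {s x} → s ∈ S → InSpan S x → InSpan S (s +ₙ x)
    span-sub  : ∀ {s x} → s ∈ S → InSpan S x → InSpan S ((-ₙ s) +ₙ x)

  Generates : Subset n → Set
  Generates S = ∀ x → InSpan S x

  Adjacent : Subset n → ℤₙ → ℤₙ → Set
  Adjacent S u v = (u -ₙ v) ∈ S

  ProperColouring : Subset n → (k : ℕ) → (ℤₙ → Fin k) → Set
  ProperColouring S k c = ∀ u v → Adjacent S u v → c u ≢ c v

  Orthogonal : {k : ℕ} → (ℤₙ → Fin k) → (ℤₙ → Fin k) → Set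
  Orthogonal c₁ c₂ = ∀ u v → u ≢ v → c₁ u ≡ c₁ v → c₂ u ≢ c₂ v

  HasOrthColouring : Subset n → ℕ → Set
  HasOrthColouring S k =
    Σ (ℤₙ → Fin k) λ c₁ → Σ (ℤₙ → Fin k) λ c₂ →
      ProperColouring S k c₁ × ProperColouring S k c₂ × Orthogonal c₁ c₂

  OChiEq : Subset n → ℕ → Set
  OChiEq S m = HasOrthColouring S m × (∀ k → HasOrthColouring S k → m ≤ k)

-- Multiply the vertices by a unit a of ℤ_{p²} and write X = a x as X₀ + X₁ p in base p.
-- The colourings x ↦ X₁ and x ↦ X₀ + t X₁ (mod p) are orthogonal, since the pair of
-- colours determines X and hence x. Along an edge with difference s, X changes by
-- σ = a s, so X₁ changes by σ₁ + c and the second colour by σ₀ + t (σ₁ + c) modulo p,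
-- where c ∈ {0, 1} is the carry out of the low digit (c = 0 when σ₀ = 0). Both changes
-- are nonzero unless a or t is forbidden: a by being a multiple of p, or, for some
-- s ∈ S with σ₀ ≠ 0 and some c, by σ₁ + c ≡ 0 (such an a is fixed by s, c and σ₀);
-- t by being 0 or, for some s and c, by σ₀ + t (σ₁ + c) ≡ 0. Counting the forbidden
-- values, |S| < (p - 1)/2 leaves a choice of both a and t. Conversely p² vertices need
-- p² distinct pairs of colours, so p colours are necessary.

module Submission where

open import Defs
open import Data.Nat using (ℕ; _*_; _∸_; _<_; NonZero)
open import Data.Nat.Primality using (Prime)
open import Data.Fin.Subset using (Subset; _∉_; ∣_∣)

open import Data.Bool using (true; false)
open import Data.Fin using (Fin; zero; suc; toℕ; fromℕ<; combine) renaming (_≟_ to _≟ᶠ_)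
open import Data.Fin.Properties
  using (toℕ-fromℕ<; toℕ-injective; toℕ<n; injective⇒≤; combine-injective; +↔⊎; *↔×)
  renaming (suc-injective to Fin-suc-injective)
open import Data.Fin.Subset using (_∈_)
open import Data.Fin.Subset.Properties using (_∈?_)
open import Data.Nat
open import Data.Nat.DivMod
open import Data.Nat.Divisibility
open import Data.Nat.Primality
open import Data.Nat.Properties
open import Algebra.Properties.CommutativeSemigroup +-commutativeSemigroup using (x∙yz≈y∙xz)
open import Data.Nat.Tactic.RingSolver using (solve-∀)
open import Data.Product using (Σ; ∃; _×_; _,_; proj₁; proj₂)
open import Data.Product.Function.NonDependent.Propositional using (_×-↔_)
open import Data.Sum using (_⊎_; inj₁; inj₂)
open import Data.Sum.Function.Propositional using (_⊎-↔_)
open import Data.Vec using (_∷_; here; there)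
open import Function using (_∘_)
open import Function.Bundles using (_↣_; Injection)
open import Function.Properties.Inverse using (↔-refl; ↔-sym; ↔-trans; ↔⇒↣)
open import Relation.Binary.PropositionalEquality
import Relation.Binary.Construct.On as On
import Relation.Binary.Reasoning.Setoid as SetoidReasoning
open import Relation.Nullary using (¬_; Dec; yes; no; contradiction)
open import Relation.Nullary.Decidable using (toSum; ¬?; _×-dec_)
open import Relation.Unary using (Decidable)

some-or-all : ∀ {n} {A B : Fin n → Set} → (∀ x → A x ⊎ B x) → ∃ A ⊎ (∀ x → B x)
some-or-all {zero} _ = inj₂ λ ()
some-or-all {suc n} f with f zero | some-or-all (f ∘ suc)
... | inj₁ a | _             = inj₁ (zero , a)
... | inj₂ _ | inj₁ (x , a) = inj₁ (suc x , a)
... | inj₂ b | inj₂ bs      = inj₂ λ { zero → b ; (suc x) → bs x }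

∃-by-counting : ∀ {n m} {C : Set} {Good : Fin n → Set} {Code : Fin n → C → Set} →
  C ↣ Fin m → m < n →
  (∀ x → Good x ⊎ ∃ (Code x)) → (∀ {x y c} → Code x c → Code y c → x ≡ y) → ∃ Good
∃-by-counting {n} {m} {Code = Code} encode m<n classify unique with some-or-all classify
... | inj₁ good = good
... | inj₂ bad  = contradiction (injective⇒≤ code-injective) (<⇒≱ m<n)
  where
  code : Fin n → Fin m
  code = Injection.to encode ∘ proj₁ ∘ bad
  code-injective : ∀ {x y} → code x ≡ code y → x ≡ y
  code-injective {x} {y} e =
    unique (proj₂ (bad x)) (subst (Code y) (sym (Injection.injective encode e)) (proj₂ (bad y)))

rank : ∀ {n} (S : Subset n) {x : Fin n} → x ∈ S → Fin ∣ S ∣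
rank (true  ∷ S) {zero}  here      = zero
rank (true  ∷ S) {suc x} (there m) = suc (rank S m)
rank (false ∷ S) {suc x} (there m) = rank S m

rank-injective : ∀ {n} (S : Subset n) {x y : Fin n} (x∈S : x ∈ S) (y∈S : y ∈ S) →
  rank S x∈S ≡ rank S y∈S → x ≡ y
rank-injective (true  ∷ S) {zero}  {zero}  here      here      _ = refl
rank-injective (true  ∷ S) {suc x} {suc y} (there m) (there k) e =
  cong suc (rank-injective S m k (Fin-suc-injective e))
rank-injective (false ∷ S) {suc x} {suc y} (there m) (there k) e = cong suc (rank-injective S m k e)

-- A union bound: each bad set is given an injective coding into Fin b resp. Fin r.
module Avoidance {n m b e r : ℕ} (S : Subset m)
  {Base : Fin n → Set} (Base? : Decidable Base)
  (codeBase : ∀ {x} → Base x → Fin b)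
  (codeBase-injective : ∀ {x y} (bx : Base x) (by : Base y) → codeBase bx ≡ codeBase by → x ≡ y)
  {Bad : Fin n → Fin m → Fin e → Set} (Bad? : ∀ x s c → Dec (Bad x s c))
  (codeBad : ∀ {x s c} → Bad x s c → Fin r)
  (codeBad-injective : ∀ {x y s c} (bx : Bad x s c) (by : Bad y s c) → codeBad bx ≡ codeBad by → x ≡ y)
  where

  Codes : Set
  Codes = Fin b ⊎ (Fin ∣ S ∣ × (Fin e × Fin r))

  Codes↣Fin : Codes ↣ Fin (b + ∣ S ∣ * (e * r))
  Codes↣Fin = ↔⇒↣ (↔-sym (↔-trans +↔⊎ (↔-refl ⊎-↔ ↔-trans *↔× (↔-refl ×-↔ *↔×))))

  Code : Fin n → Codes → Set
  Code x (inj₁ i)           = Σ (Base x) λ bx → codeBase bx ≡ i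
  Code x (inj₂ (j , c , i)) =
    ∃ λ s → Σ (s ∈ S) λ s∈S → rank S s∈S ≡ j × Σ (Bad x s c) λ bad → codeBad bad ≡ i

  code-unique : ∀ {x y w} → Code x w → Code y w → x ≡ y
  code-unique {w = inj₁ _} (bx , e) (by , e′) = codeBase-injective bx by (trans e (sym e′))
  code-unique {w = inj₂ _} (s , s∈S , eₛ , bad , e) (s′ , s′∈S , eₛ′ , bad′ , e′)
    with refl ← rank-injective S s∈S s′∈S (trans eₛ (sym eₛ′))
    = codeBad-injective bad bad′ (trans e (sym e′))

  Avoids : Fin n → Set
  Avoids x = ¬ Base x × (∀ s → s ∈ S → ∀ c → ¬ Bad x s c)

  examine : ∀ x s → ∃ (Code x) ⊎ (s ∈ S → ∀ c → ¬ Bad x s c)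
  examine x s with s ∈? S
  ... | no s∉S  = inj₂ λ s∈S → contradiction s∈S s∉S
  ... | yes s∈S with some-or-all (λ c → toSum (Bad? x s c))
  ...   | inj₁ (c , bad) = inj₁ (inj₂ (rank S s∈S , c , codeBad bad) , s , s∈S , refl , bad , refl)
  ...   | inj₂ good      = inj₂ λ _ → good

  classify : ∀ x → Avoids x ⊎ ∃ (Code x)
  classify x with Base? x | some-or-all (examine x)
  ... | yes bx  | _               = inj₂ (inj₁ (codeBase bx) , bx , refl)
  ... | no _    | inj₁ (_ , code) = inj₂ code
  ... | no ¬bx  | inj₂ good       = inj₁ (¬bx , good)

  avoid : b + ∣ S ∣ * (e * r) < n → ∃ Avoids
  avoid count = ∃-by-counting Codes↣Fin count classify code-unique

∣-<⇒≡0 : ∀ {n d} → n ∣ d → d < n → d ≡ 0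
∣-<⇒≡0 {d = zero}  _   _   = refl
∣-<⇒≡0 {d = suc _} n∣d d<n = contradiction (∣⇒≤ n∣d) (<⇒≱ d<n)

module Congruence (n : ℕ) .{{_ : NonZero n}} where

  infix 4 _≋_
  _≋_ : ℕ → ℕ → Set
  x ≋ y = x % n ≡ y % n

  module ≋-Reasoning = SetoidReasoning (On.setoid {B = ℕ} (setoid ℕ) (_% n))

  0%n≡0 : 0 % n ≡ 0
  0%n≡0 = n∣m⇒m%n≡0 0 n (n ∣0)

  %-≋ : ∀ x → x % n ≋ x
  %-≋ x = m%n%n≡m%n x n

  +-cong-≋ : ∀ {a b c d} → a ≋ b → c ≋ d → a + c ≋ b + d
  +-cong-≋ {a} {b} {c} {d} a≋b c≋d = begin
    (a + c) % n             ≡⟨ %-distribˡ-+ a c n ⟩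
    (a % n + c % n) % n     ≡⟨ cong₂ (λ x y → (x + y) % n) a≋b c≋d ⟩
    (b % n + d % n) % n     ≡⟨ %-distribˡ-+ b d n ⟨
    (b + d) % n             ∎
    where open ≡-Reasoning

  *-cong-≋ : ∀ {a b c d} → a ≋ b → c ≋ d → a * c ≋ b * d
  *-cong-≋ {a} {b} {c} {d} a≋b c≋d = begin
    (a * c) % n             ≡⟨ %-distribˡ-* a c n ⟩
    (a % n * (c % n)) % n   ≡⟨ cong₂ (λ x y → (x * y) % n) a≋b c≋d ⟩
    (b % n * (d % n)) % n   ≡⟨ %-distribˡ-* b d n ⟨
    (b * d) % n             ∎
    where open ≡-Reasoning

  ≋⇒≡ : ∀ {x y} → x < n → y < n → x ≋ y → x ≡ y
  ≋⇒≡ x<n y<n x≋y = trans (sym (m<n⇒m%n≡m x<n)) (trans x≋y (m<n⇒m%n≡m y<n))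

  ≋0⇒∣ : ∀ {x} → x ≋ 0 → n ∣ x
  ≋0⇒∣ {x} x≋0 = m%n≡0⇒n∣m x n (trans x≋0 0%n≡0)

  ∣⇒≋0 : ∀ {x} → n ∣ x → x ≋ 0
  ∣⇒≋0 {x} n∣x = trans (n∣m⇒m%n≡0 x n n∣x) (sym 0%n≡0)

  ≋⇒∣∸ : ∀ {x y} → x ≋ y → n ∣ y ∸ x
  ≋⇒∣∸ {x} {y} x≋y = divides (y / n ∸ x / n) (begin
    y ∸ x                                  ≡⟨ cong₂ _∸_ (m≡m%n+[m/n]*n y n) (m≡m%n+[m/n]*n x n) ⟩
    (y % n + y / n * n) ∸ (x % n + x / n * n) ≡⟨ cong (λ r → (y % n + y / n * n) ∸ (r + x / n * n)) x≋y ⟩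
    (y % n + y / n * n) ∸ (y % n + x / n * n) ≡⟨ [m+n]∸[m+o]≡n∸o (y % n) (y / n * n) (x / n * n) ⟩
    y / n * n ∸ x / n * n                  ≡⟨ *-distribʳ-∸ n (y / n) (x / n) ⟨
    (y / n ∸ x / n) * n                    ∎)
    where open ≡-Reasoning

  ∣∸⇒≋ : ∀ {x y} → x ≤ y → n ∣ y ∸ x → x ≋ y
  ∣∸⇒≋ {x} {y} x≤y n∣y∸x = begin
    x % n             ≡⟨ %-remove-+ʳ x n∣y∸x ⟨
    (x + (y ∸ x)) % n ≡⟨ cong (_% n) (m+[n∸m]≡n x≤y) ⟩
    y % n             ∎
    where open ≡-Reasoning

  *-cancelˡ-≋ : ∀ a → (∀ {d} → n ∣ a * d → n ∣ d) → ∀ {x y} → a * x ≋ a * y → x ≋ y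
  *-cancelˡ-≋ a cancel {x} {y} ax≋ay with ≤-total x y
  ... | inj₁ x≤y = ∣∸⇒≋ x≤y (cancel (subst (n ∣_) (sym (*-distribˡ-∸ a y x)) (≋⇒∣∸ ax≋ay)))
  ... | inj₂ y≤x =
    sym (∣∸⇒≋ y≤x (cancel (subst (n ∣_) (sym (*-distribˡ-∸ a x y)) (≋⇒∣∸ (sym ax≋ay)))))

  mod-≡⇒≋ : ∀ {x y} → x mod n ≡ y mod n → x ≋ y
  mod-≡⇒≋ e = trans (sym (toℕ-fromℕ< _)) (trans (cong toℕ e) (toℕ-fromℕ< _))

  +-cancelˡ-≋ : ∀ k {x y} → k + x ≋ k + y → x ≋ y
  +-cancelˡ-≋ k {x} {y} kx≋ky with ≤-total x y
  ... | inj₁ x≤y = ∣∸⇒≋ x≤y (subst (n ∣_) ([m+n]∸[m+o]≡n∸o k y x) (≋⇒∣∸ kx≋ky))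
  ... | inj₂ y≤x = sym (∣∸⇒≋ y≤x (subst (n ∣_) ([m+n]∸[m+o]≡n∸o k x y) (≋⇒∣∸ (sym kx≋ky))))

  +-cancelʳ-≋ : ∀ k {x y} → x + k ≋ y + k → x ≋ y
  +-cancelʳ-≋ k {x} {y} xk≋yk = +-cancelˡ-≋ k (subst₂ _≋_ (+-comm x k) (+-comm y k) xk≋yk)

module _ (n : ℕ) .{{_ : NonZero n}} where
  open ZMod n
  open Congruence n

  -ₙ-correct : ∀ u v → toℕ v + toℕ (u -ₙ v) ≋ toℕ u
  -ₙ-correct u v = begin
    V + toℕ (u -ₙ v)          ≡⟨ cong (V +_) (toℕ-fromℕ< _) ⟩
    V + (U + toℕ (-ₙ v)) % n  ≈⟨ +-cong-≋ {V} refl (%-≋ _) ⟩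
    V + (U + toℕ (-ₙ v))      ≡⟨ cong (λ z → V + (U + z)) (toℕ-fromℕ< _) ⟩
    V + (U + (n ∸ V) % n)     ≈⟨ +-cong-≋ {V} refl (+-cong-≋ {U} refl (%-≋ _)) ⟩
    V + (U + (n ∸ V))         ≡⟨ x∙yz≈y∙xz V U (n ∸ V) ⟩
    U + (V + (n ∸ V))         ≡⟨ cong (U +_) (m+[n∸m]≡n (<⇒≤ (toℕ<n v))) ⟩
    U + n                     ≈⟨ [m+n]%n≡m%n U n ⟩
    U                         ∎
    where
    open ≋-Reasoning
    U V : ℕ
    U = toℕ u
    V = toℕ v

  orthColouring-size : ∀ {S k} → HasOrthColouring S k → n ≤ k * k
  orthColouring-size (c₁ , c₂ , _ , _ , orth) = injective⇒≤ pair-injective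
    where
    pair-injective : ∀ {x y} → combine (c₁ x) (c₂ x) ≡ combine (c₁ y) (c₂ y) → x ≡ y
    pair-injective {x} {y} e with x ≟ᶠ y
    ... | yes x≡y = x≡y
    ... | no x≢y  = contradiction (proj₂ same) (orth x y x≢y (proj₁ same))
      where
      same : c₁ x ≡ c₁ y × c₂ x ≡ c₂ y
      same = combine-injective (c₁ x) (c₂ x) (c₁ y) (c₂ y) e

module _ (d : ℕ) .{{_ : NonZero d}} where

  [m+kn]/n≡m/n+k : ∀ x k → (x + k * d) / d ≡ x / d + k
  [m+kn]/n≡m/n+k x k = trans (+-distrib-/-∣ʳ x (n∣m*n k)) (cong (x / d +_) (m*n/n≡m k d))

  +-distrib-/-carry : ∀ x y → (x + y) / d ≡ (x % d + y % d) / d + (x / d + y / d)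
  +-distrib-/-carry x y = begin
    (x + y) / d                                ≡⟨ cong (_/ d) split ⟩
    (x % d + y % d + (x / d + y / d) * d) / d  ≡⟨ [m+kn]/n≡m/n+k (x % d + y % d) (x / d + y / d) ⟩
    (x % d + y % d) / d + (x / d + y / d)      ∎
    where
    open ≡-Reasoning
    regroup : ∀ r q r′ q′ d → r + q * d + (r′ + q′ * d) ≡ r + r′ + (q + q′) * d
    regroup = solve-∀
    split : x + y ≡ x % d + y % d + (x / d + y / d) * d
    split = trans (cong₂ _+_ (m≡m%n+[m/n]*n x d) (m≡m%n+[m/n]*n y d)) (regroup (x % d) (x / d) (y % d) (y / d) d)

  carry≤1 : ∀ x y → (x % d + y % d) / d ≤ 1
  carry≤1 x y = ≤-pred (m<n*o⇒m/o<n {n = 2} digits<2d)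
    where
    digits<2d : x % d + y % d < 2 * d
    digits<2d = subst (x % d + y % d <_) (cong (d +_) (sym (+-identityʳ d)))
      (+-mono-< (m%n<n x d) (m%n<n y d))

  carry≡0 : ∀ x y → y % d ≡ 0 → (x % d + y % d) / d ≡ 0
  carry≡0 x y y%d≡0 = m<n⇒m/n≡0 (subst (_< d) (sym (trans (cong (x % d +_) y%d≡0) (+-identityʳ _))) (m%n<n x d))

room : ∀ k p → 2 * k < p ∸ 1 → 2 * k + 2 ≤ p
room k (suc p) 2k<p = subst (_≤ suc p) (+-comm 2 (2 * k)) (s≤s 2k<p)

multiplier-count : ∀ k p → 2 * k + 2 ≤ p → p + k * (2 * p) < p * p
multiplier-count k p 2k+2≤p = <-≤-trans
  (m<m+n (p + k * (2 * p)) (<-≤-trans (≤-<-trans z≤n (m<m+n (2 * k) z<s)) 2k+2≤p))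
  (subst (_≤ p * p) (expand k p) (*-monoˡ-≤ p 2k+2≤p))
  where
  expand : ∀ k p → (2 * k + 2) * p ≡ p + k * (2 * p) + p
  expand = solve-∀

offset-count : ∀ k p → 2 * k + 2 ≤ p → 1 + k * (2 * 1) < p
offset-count k p 2k+2≤p = subst (_≤ p) (expand k) 2k+2≤p
  where
  expand : ∀ k → 2 * k + 2 ≡ suc (1 + k * (2 * 1))
  expand = solve-∀

square-≤⇒≤ : ∀ {m n} → m * m ≤ n * n → m ≤ n
square-≤⇒≤ m²≤n² = ≮⇒≥ λ n<m → <⇒≱ (*-mono-< n<m n<m) m²≤n²

module PrimeSquare (p : ℕ) (p-prime : Prime p) where

  instance
    p≢0 : NonZero p
    p≢0 = prime⇒nonZero p-prime
    p*p≢0 : NonZero (p * p)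
    p*p≢0 = m*n≢0 p p

  open ZMod (p * p)
  module ModN = Congruence (p * p)
  open Congruence p

  euclid : ∀ {a d} → ¬ p ∣ a → p ∣ a * d → p ∣ d
  euclid {a} {d} p∤a p∣ad with euclidsLemma a d p-prime p∣ad
  ... | inj₁ p∣a = contradiction p∣a p∤a
  ... | inj₂ p∣d = p∣d

  euclid² : ∀ {a d} → ¬ p ∣ a → p * p ∣ a * d → p * p ∣ d
  euclid² {a} {d} p∤a p²∣ad with euclid p∤a (∣-trans (m∣m*n p) p²∣ad)
  ... | divides q refl =
    *-monoˡ-∣ p (euclid p∤a (*-cancelʳ-∣ p (subst (p * p ∣_) (sym (*-assoc a q p)) p²∣ad)))

  /p<p : ∀ {x} → x < p * p → x / p < p
  /p<p = m<n*o⇒m/o<n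

  digits-injective : ∀ {x y} → x % p ≡ y % p → x / p ≡ y / p → x ≡ y
  digits-injective {x} {y} lo hi = begin
    x                   ≡⟨ m≡m%n+[m/n]*n x p ⟩
    x % p + x / p * p   ≡⟨ cong₂ (λ r q → r + q * p) lo hi ⟩
    y % p + y / p * p   ≡⟨ m≡m%n+[m/n]*n y p ⟨
    y                   ∎
    where open ≡-Reasoning

  module DigitsOfSum (Y σ : ℕ) where

    X : ℕ
    X = (Y + σ) % (p * p)

    carry : Fin 2
    carry = fromℕ< (s≤s (carry≤1 p Y σ))

    toℕ-carry : toℕ carry ≡ (Y % p + σ % p) / p
    toℕ-carry = toℕ-fromℕ< _

    carry-zero : σ % p ≡ 0 → carry ≡ zero
    carry-zero σ%p≡0 = toℕ-injective (trans toℕ-carry (carry≡0 p Y σ σ%p≡0))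

    low : X ≋ Y % p + σ % p
    low = begin
      X               ≈⟨ m∣n⇒o%n%m≡o%m p (p * p) (Y + σ) (m∣m*n p) ⟩
      Y + σ           ≈⟨ +-cong-≋ (%-≋ Y) (%-≋ σ) ⟨
      Y % p + σ % p   ∎
      where open ≋-Reasoning

    high : X / p ≋ Y / p + (σ / p + toℕ carry)
    high = begin
      X / p                                  ≡⟨ m%[n*o]/o≡m/o%n (Y + σ) p p ⟩
      (Y + σ) / p % p                        ≈⟨ %-≋ _ ⟩
      (Y + σ) / p                            ≡⟨ +-distrib-/-carry p Y σ ⟩
      (Y % p + σ % p) / p + (Y / p + σ / p)  ≡⟨ cong (_+ (Y / p + σ / p)) toℕ-carry ⟨
      toℕ carry + (Y / p + σ / p)            ≡⟨ x∙yz≈y∙xz (toℕ carry) (Y / p) (σ / p) ⟩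
      Y / p + (toℕ carry + σ / p)            ≡⟨ cong (Y / p +_) (+-comm (toℕ carry) (σ / p)) ⟩
      Y / p + (σ / p + toℕ carry)            ∎
      where open ≋-Reasoning

  scale : ℕ → ℤₙ → ℕ
  scale a x = a * toℕ x % (p * p)

  scale-split : ∀ a u v → scale a u ≡ (scale a v + scale a (u -ₙ v)) % (p * p)
  scale-split a u v = begin
    a * toℕ u                           ≈⟨ ModN.*-cong-≋ {a} refl (-ₙ-correct (p * p) u v) ⟨
    a * (toℕ v + toℕ (u -ₙ v))          ≡⟨ *-distribˡ-+ a (toℕ v) (toℕ (u -ₙ v)) ⟩
    a * toℕ v + a * toℕ (u -ₙ v)        ≈⟨ ModN.+-cong-≋ (ModN.%-≋ _) (ModN.%-≋ _) ⟨
    scale a v + scale a (u -ₙ v)        ∎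
    where open ModN.≋-Reasoning

  -- c ranges over the possible carries out of the low digit along an edge.
  Separates : ℕ → ℕ → Subset (p * p) → Set
  Separates a t S = ∀ s → s ∈ S → ∀ (c : Fin 2) → (scale a s % p ≡ 0 → c ≡ zero) →
    ¬ (scale a s / p + toℕ c ≋ 0) × ¬ (scale a s % p + t * (scale a s / p + toℕ c) ≋ 0)

  module Colouring (a t : ℕ) where

    colour₁ : ℤₙ → Fin p
    colour₁ x = (scale a x / p) mod p

    colour₂ : ℤₙ → Fin p
    colour₂ x = (scale a x % p + t * (scale a x / p)) mod p

    module Edge (u v : ℤₙ) where
      Y σ : ℕ
      Y = scale a v
      σ = scale a (u -ₙ v)
      open DigitsOfSum Y σ public

      scale≡X : scale a u ≡ X
      scale≡X = scale-split a u v

    proper₁ : ∀ S → Separates a t S → ProperColouring S p colour₁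
    proper₁ S sep u v adj same = proj₁ (sep _ adj carry carry-zero) (+-cancelˡ-≋ (Y / p) (begin
      Y / p + (σ / p + toℕ carry)   ≈⟨ high ⟨
      X / p                         ≡⟨ cong (_/ p) scale≡X ⟨
      scale a u / p                 ≈⟨ mod-≡⇒≋ same ⟩
      Y / p                         ≡⟨ +-identityʳ (Y / p) ⟨
      Y / p + 0                     ∎))
      where
      open Edge u v
      open ≋-Reasoning

    proper₂ : ∀ S → Separates a t S → ProperColouring S p colour₂
    proper₂ S sep u v adj same = proj₂ (sep _ adj carry carry-zero) (+-cancelˡ-≋ (Y % p + t * (Y / p)) (begin
      Y % p + t * (Y / p) + (σ % p + t * (σ / p + toℕ carry))  ≡⟨ regroup (Y % p) (Y / p) (σ % p) (σ / p) (toℕ carry) t ⟩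
      Y % p + σ % p + t * (Y / p + (σ / p + toℕ carry))        ≈⟨ +-cong-≋ low (*-cong-≋ {t} refl high) ⟨
      X + t * (X / p)                                          ≈⟨ +-cong-≋ (%-≋ X) refl ⟨
      X % p + t * (X / p)                                      ≡⟨ cong (λ z → z % p + t * (z / p)) scale≡X ⟨
      scale a u % p + t * (scale a u / p)                      ≈⟨ mod-≡⇒≋ same ⟩
      Y % p + t * (Y / p)                                      ≡⟨ +-identityʳ _ ⟨
      Y % p + t * (Y / p) + 0                                  ∎))
      where
      open Edge u v
      open ≋-Reasoning
      regroup : ∀ r q r′ q′ c t → r + t * q + (r′ + t * (q′ + c)) ≡ r + r′ + t * (q + (q′ + c))
      regroup = solve-∀

    orthogonal : ¬ p ∣ a → Orthogonal colour₁ colour₂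
    orthogonal p∤a u v u≢v same₁ same₂ = u≢v (toℕ-injective (ModN.≋⇒≡ (toℕ<n u) (toℕ<n v)
      (ModN.*-cancelˡ-≋ a (euclid² p∤a) (digits-injective low-eq high-eq))))
      where
      high-eq : scale a u / p ≡ scale a v / p
      high-eq = ≋⇒≡ (/p<p (m%n<n _ (p * p))) (/p<p (m%n<n _ (p * p))) (mod-≡⇒≋ same₁)
      low-eq : scale a u % p ≡ scale a v % p
      low-eq = ≋⇒≡ (m%n<n _ p) (m%n<n _ p) (+-cancelʳ-≋ (t * (scale a v / p)) (begin
        scale a u % p + t * (scale a v / p)  ≡⟨ cong (λ z → scale a u % p + t * z) high-eq ⟨
        scale a u % p + t * (scale a u / p)  ≈⟨ mod-≡⇒≋ same₂ ⟩
        scale a v % p + t * (scale a v / p)  ∎))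
        where open ≋-Reasoning

    hasOrthColouring : ∀ S → ¬ p ∣ a → Separates a t S → HasOrthColouring S p
    hasOrthColouring S p∤a sep = colour₁ , colour₂ , proper₁ S sep , proper₂ S sep , orthogonal p∤a

  toℕ-0ₙ : toℕ 0ₙ ≡ 0
  toℕ-0ₙ = trans (toℕ-fromℕ< _) ModN.0%n≡0

  low≢0⇒p∤ : ∀ a s → ¬ scale a s % p ≡ 0 → ¬ p ∣ toℕ s
  low≢0⇒p∤ a s low≢0 p∣s = low≢0 (n∣m⇒m%n≡0 _ p (%-presˡ-∣ (∣n⇒∣m*n a p∣s) (m∣m*n p)))

  high≢0 : ∀ a s → ¬ p ∣ a → s ≢ 0ₙ → scale a s % p ≡ 0 → ¬ (scale a s / p ≋ 0)
  high≢0 a s p∤a s≢0ₙ low≡0 high≋0 = s≢0ₙ (toℕ-injective (trans s≡0 (sym toℕ-0ₙ)))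
    where
    scale≡0 : scale a s ≡ 0
    scale≡0 = digits-injective (trans low≡0 (sym 0%n≡0))
      (trans (≋⇒≡ (/p<p (m%n<n _ (p * p))) (>-nonZero⁻¹ p) high≋0) (sym (0/n≡0 p)))
    s≡0 : toℕ s ≡ 0
    s≡0 = ∣-<⇒≡0 (euclid² p∤a (ModN.≋0⇒∣ (trans scale≡0 (sym ModN.0%n≡0)))) (toℕ<n s)

  module Choice (S : Subset (p * p)) where

    Wraps : Fin (p * p) → ℤₙ → Fin 2 → Set
    Wraps a s c = ¬ scale (toℕ a) s % p ≡ 0 × scale (toℕ a) s / p + toℕ c ≋ 0

    wraps? : ∀ a s c → Dec (Wraps a s c)
    wraps? a s c = ¬? (scale (toℕ a) s % p ≟ 0) ×-dec (_ ≟ _)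

    multiple-injective : ∀ {a a′} → p ∣ toℕ a → p ∣ toℕ a′ →
      (toℕ a / p) mod p ≡ (toℕ a′ / p) mod p → a ≡ a′
    multiple-injective {a} {a′} p∣a p∣a′ e = toℕ-injective (digits-injective
      (trans (n∣m⇒m%n≡0 _ p p∣a) (sym (n∣m⇒m%n≡0 _ p p∣a′)))
      (≋⇒≡ (/p<p (toℕ<n a)) (/p<p (toℕ<n a′)) (mod-≡⇒≋ e)))

    -- Wrapping fixes the high digit of scale a s, so its low digit fixes scale a s;
    -- and s is a unit, so scale a s fixes a.
    wraps-injective : ∀ {a a′ s c} → Wraps a s c → Wraps a′ s c →
      (scale (toℕ a) s % p) mod p ≡ (scale (toℕ a′) s % p) mod p → a ≡ a′
    wraps-injective {a} {a′} {s} {c} (low≢0 , wraps) (_ , wraps′) e =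
      toℕ-injective (ModN.≋⇒≡ (toℕ<n a) (toℕ<n a′)
        (ModN.*-cancelˡ-≋ (toℕ s) (euclid² (low≢0⇒p∤ (toℕ a) s low≢0)) sa≋sa′))
      where
      scale≡ : scale (toℕ a) s ≡ scale (toℕ a′) s
      scale≡ = digits-injective
        (≋⇒≡ (m%n<n _ p) (m%n<n _ p) (mod-≡⇒≋ e))
        (≋⇒≡ (/p<p (m%n<n _ (p * p))) (/p<p (m%n<n _ (p * p)))
          (+-cancelʳ-≋ (toℕ c) (trans wraps (sym wraps′))))
      sa≋sa′ : toℕ s * toℕ a ModN.≋ toℕ s * toℕ a′
      sa≋sa′ = subst₂ ModN._≋_ (*-comm (toℕ a) (toℕ s)) (*-comm (toℕ a′) (toℕ s)) scale≡

    module Multiplier = Avoidance {e = 2} S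
      (λ a → p ∣? toℕ a) (λ {a} _ → (toℕ a / p) mod p) multiple-injective
      wraps? (λ {a} {s} _ → (scale (toℕ a) s % p) mod p) wraps-injective

    Hits : ℕ → Fin p → ℤₙ → Fin 2 → Set
    Hits a t s c = ¬ (scale a s / p + toℕ c ≋ 0) × scale a s % p + toℕ t * (scale a s / p + toℕ c) ≋ 0

    hits? : ∀ a t s c → Dec (Hits a t s c)
    hits? a t s c = ¬? (_ ≟ _) ×-dec (_ ≟ _)

    -- t ↦ low + t · high is injective modulo p because high is a unit.
    hits-injective : ∀ {a t t′ s c} → Hits a t s c → Hits a t′ s c → t ≡ t′
    hits-injective {a} {t} {t′} {s} {c} (high≢0 , hit) (_ , hit′) =
      toℕ-injective (≋⇒≡ (toℕ<n t) (toℕ<n t′) (*-cancelˡ-≋ high (euclid (high≢0 ∘ ∣⇒≋0)) th≋t′h))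
      where
      high : ℕ
      high = scale a s / p + toℕ c
      th≋t′h : high * toℕ t ≋ high * toℕ t′
      th≋t′h = subst₂ _≋_ (*-comm (toℕ t) high) (*-comm (toℕ t′) high)
        (+-cancelˡ-≋ (scale a s % p) (trans hit (sym hit′)))

    module Offset (a : ℕ) = Avoidance {b = 1} {e = 2} {r = 1} S
      (λ t → toℕ t ≟ 0) (λ _ → zero) (λ t≡0 t′≡0 _ → toℕ-injective (trans t≡0 (sym t′≡0)))
      (hits? a) (λ _ → zero) (λ h h′ _ → hits-injective {a} h h′)

    separates : ∀ {a t} → 0ₙ ∉ S → Multiplier.Avoids a → Offset.Avoids (toℕ a) t →
      Separates (toℕ a) (toℕ t) S
    separates {a} {t} 0∉S (p∤a , no-wraps) (t≢0 , no-hits) s s∈S c low≡0⇒c≡0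
      with scale (toℕ a) s % p ≟ 0
    ... | no low≢0 = high-ok , λ hit → no-hits s s∈S c (high-ok , hit)
      where
      high-ok : ¬ (scale (toℕ a) s / p + toℕ c ≋ 0)
      high-ok wraps = no-wraps s s∈S c (low≢0 , wraps)
    ... | yes low≡0 with refl ← low≡0⇒c≡0 low≡0 = high-ok , low-ok
      where
      high : ℕ
      high = scale (toℕ a) s / p
      high-ok : ¬ (high + 0 ≋ 0)
      high-ok = high≢0 (toℕ a) s p∤a (λ s≡0ₙ → 0∉S (subst (_∈ S) s≡0ₙ s∈S)) low≡0
              ∘ subst (_≋ 0) (+-identityʳ high)
      p∤t : ¬ p ∣ toℕ t
      p∤t p∣t = t≢0 (∣-<⇒≡0 p∣t (toℕ<n t))
      low-ok : ¬ (scale (toℕ a) s % p + toℕ t * (high + 0) ≋ 0)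
      low-ok hit =
        high-ok (∣⇒≋0 (euclid p∤t (≋0⇒∣ (subst (λ l → l + toℕ t * (high + 0) ≋ 0) low≡0 hit))))

    orthColouring : 0ₙ ∉ S → 2 * ∣ S ∣ < p ∸ 1 → HasOrthColouring S p
    orthColouring 0∉S small
      with a , a-avoids ← Multiplier.avoid (multiplier-count ∣ S ∣ p (room ∣ S ∣ p small))
      with t , t-avoids ← Offset.avoid (toℕ a) (offset-count ∣ S ∣ p (room ∣ S ∣ p small))
      = Colouring.hasOrthColouring (toℕ a) (toℕ t) S (proj₁ a-avoids) (separates 0∉S a-avoids t-avoids)

theorem6 : (p : ℕ) → Prime p → .{{_ : NonZero (p * p)}} →
    (S : Subset (p * p)) →
    ZMod.Generates (p * p) S → ZMod.SymmetricSet (p * p) S → ZMod.0ₙ (p * p) ∉ S →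
    2 * ∣ S ∣ < p ∸ 1 →
    ZMod.OChiEq (p * p) S p
theorem6 p p-prime S _ _ 0∉S small =
  orthColouring 0∉S small , λ _ colouring → square-≤⇒≤ (orthColouring-size (p * p) colouring)
  where
  open PrimeSquare p p-prime
  open Choice S
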